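{- Let $N$ be a natural number and $P=\{a\subseteq N:|a|\geq 2\}$. If $A\subseteq P$ satisfies $\|A\|_3=k$, then \[|A|\leq 2^N-2^k\,2^{N/2^k}+2^k-1.\]
   Context: $N$ is identified with $\{0,\ldots,N-1\}$. For $A\subseteq P$ and $z\subseteq N$ let $A\restriction z=\{a\in A: a\subseteq z\}$. The graph coloring norm is defined recursively: $\|A\|_3\geq 0$ always; $\|A\|_3\geq 1$ iff $A\neq\emptyset$; for $n\geq 1$, $\|A\|_3\geq n+1$ iff for every $z\subseteq N$, either $\|A\restriction z\|_3\geq n$ or $\|A\restriction (N\setminus z)\|_3\geq n$; $\|A\|_3=n$ means $\|A\|_3\geq n$ but not $\|A\|_3\geq n+1$. -}

module Defs where

open import Data.Nat using (ℕ; zero; suc)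
open import Data.Bool using (Bool; true; false; _∧_)
open import Data.List using (List; []; _∷_; _++_; map)
open import Data.Vec using (_∷_; [])
open import Data.Fin.Subset using (Subset; ∁; inside; outside)
open import Data.Fin.Subset.Properties using (_⊆?_)
open import Data.Product using (∃)
open import Data.Sum using (_⊎_)
open import Data.Unit using (⊤)
open import Relation.Nullary.Decidable using (⌊_⌋)
open import Relation.Binary.PropositionalEquality using (_≡_)

Family : ℕ → Set
Family N = Subset N → Bool

allSubsets : (N : ℕ) → List (Subset N)
allSubsets zero = [] ∷ []
allSubsets (suc N) = map (outside ∷_) (allSubsets N) ++ map (inside ∷_) (allSubsets N)

countTrue : {X : Set} → (X → Bool) → List X → ℕ
countTrue p [] = zero
countTrue p (x ∷ xs) with p x
... | true  = suc (countTrue p xs)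
... | false = countTrue p xs

card : {N : ℕ} → Family N → ℕ
card {N} A = countTrue A (allSubsets N)

_↾_ : {N : ℕ} → Family N → Subset N → Family N
(A ↾ z) a = A a ∧ ⌊ a ⊆? z ⌋

NormGE : {N : ℕ} → ℕ → Family N → Set
NormGE zero A = ⊤
NormGE {N} (suc zero) A = ∃ λ (a : Subset N) → A a ≡ true
NormGE {N} (suc (suc n)) A =
  (z : Subset N) → NormGE (suc n) (A ↾ z) ⊎ NormGE (suc n) (A ↾ ∁ z)

NormEq : {N : ℕ} → ℕ → Family N → Set
NormEq n A = NormGE n A × (NormGE (suc n) A → ⊥)
  where
  open import Data.Product using (_×_)
  open import Data.Empty using (⊥)

module Submission where

-- Let m = 2^n. If ‖B‖₃ ≤ n and all members of B lie in z with ∣z∣ = s, then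
-- ∣B∣ ≤ 2^s + m − 1 − m·2^(s/m). Induct on n; for n = 0, B is empty. Otherwise some w has
-- ‖B ↾ w‖₃ ≤ n−1 and ‖B ↾ ∁w‖₃ ≤ n−1, and these restrictions live in z ∩ w and z ∩ ∁w.
-- A member of B in neither restriction is a subset of z contained in neither w nor ∁w, so
-- ∣B∣ ≤ ∣B ↾ w∣ + ∣B ↾ ∁w∣ + 2^s − 2^s₁ − 2^s₂ + 1 (the empty set lies in both). With
-- P = 2^s₁, R = 2^s₂, the slacks M₁ ≥ m·P^(1/m) and M₂ ≥ m·R^(1/m) of the two restrictions add
-- up to at most the slack of B at level 2m, and (M₁ + M₂)² ≥ 4M₁M₂ ≥ (2m)²·(PR)^(1/m).
-- The bound is decidable, so the induction is run as its contrapositive: a failure of the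
-- bound yields ‖B‖₃ ≥ n+1. The theorem is the case z = N.

open import Defs
open import Data.Nat using (ℕ; zero; suc; _+_; _*_; _∸_; _^_; _≤_; _<_; z≤n; s≤s; _≤?_)
open import Data.Nat.Properties
open import Data.Nat.Tactic.RingSolver using (solve-∀)
open import Algebra.Properties.CommutativeSemigroup *-commutativeSemigroup
  using () renaming (interchange to *-interchange)
open import Algebra.Properties.CommutativeSemigroup +-commutativeSemigroup
  using () renaming (interchange to +-interchange)
open import Data.Bool using (Bool; true; false; _∧_)
open import Data.Bool.Properties using (∧-conicalˡ; ∧-conicalʳ; ∧-zeroʳ)
open import Data.List using (List; []; _∷_; _++_; map)
open import Data.Vec using (_∷_; [])
open import Data.Fin.Subset using (Subset; ∣_∣; _∩_; ∁; ⊤; ⊥; inside; outside)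
open import Data.Fin.Subset.Properties using (_⊆?_; ∣⊤∣≡n; ∣⊥∣≡0)
open import Data.Product using (_×_; _,_; ∃)
open import Data.Sum using (inj₁; inj₂)
open import Data.Empty using (⊥-elim)
open import Function using (_∘_)
open import Relation.Nullary using (¬_; Dec; yes; no)
open import Relation.Nullary.Decidable using (does; _×-dec_; isYes≗does)
open import Relation.Binary.PropositionalEquality

^-distribʳ-* : ∀ x y n → (x * y) ^ n ≡ x ^ n * y ^ n
^-distribʳ-* x y zero    = refl
^-distribʳ-* x y (suc n) = begin
  x * y * (x * y) ^ n     ≡⟨ cong (x * y *_) (^-distribʳ-* x y n) ⟩
  x * y * (x ^ n * y ^ n) ≡⟨ *-interchange x y (x ^ n) (y ^ n) ⟩
  x * x ^ n * (y * y ^ n) ∎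
  where open ≡-Reasoning

4x[x+d]≤[2x+d]² : ∀ x d → 4 * (x * (x + d)) ≤ (x + (x + d)) ^ 2
4x[x+d]≤[2x+d]² x d = begin
  4 * (x * (x + d))         ≤⟨ m≤m+n _ (d * d) ⟩
  4 * (x * (x + d)) + d * d ≡⟨ expand x d ⟩
  (x + (x + d)) ^ 2         ∎
  where
  open ≤-Reasoning
  expand : ∀ a b → 4 * (a * (a + b)) + b * b ≡ (a + (a + b)) * ((a + (a + b)) * 1)
  expand = solve-∀

x≤y⇒4xy≤[x+y]² : ∀ {x y} → x ≤ y → 4 * (x * y) ≤ (x + y) ^ 2
x≤y⇒4xy≤[x+y]² {x} {y} x≤y with y ∸ x | m+[n∸m]≡n x≤y
... | d | refl = 4x[x+d]≤[2x+d]² x d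

4xy≤[x+y]² : ∀ x y → 4 * (x * y) ≤ (x + y) ^ 2
4xy≤[x+y]² x y with ≤-total x y
... | inj₁ x≤y = x≤y⇒4xy≤[x+y]² x≤y
... | inj₂ y≤x =
  subst₂ (λ a b → 4 * a ≤ b) (*-comm y x) (cong (_^ 2) (+-comm y x)) (x≤y⇒4xy≤[x+y]² y≤x)

[2m]^[2m]*PR≤[x+y]^[2m] : ∀ m x y P R → m ^ m * P ≤ x ^ m → m ^ m * R ≤ y ^ m →
  (2 * m) ^ (2 * m) * (P * R) ≤ (x + y) ^ (2 * m)
[2m]^[2m]*PR≤[x+y]^[2m] m x y P R mᵐP≤xᵐ mᵐR≤yᵐ = begin
  (2 * m) ^ (2 * m) * (P * R)       ≡⟨ cong (_* (P * R)) (sym (^-*-assoc (2 * m) 2 m)) ⟩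
  ((2 * m) ^ 2) ^ m * (P * R)       ≡⟨ cong (λ t → t ^ m * (P * R)) (square m) ⟩
  (4 * (m * m)) ^ m * (P * R)       ≡⟨ cong (_* (P * R)) (^-distribʳ-* 4 (m * m) m) ⟩
  4 ^ m * (m * m) ^ m * (P * R)     ≡⟨ cong (λ t → 4 ^ m * t * (P * R)) (^-distribʳ-* m m m) ⟩
  4 ^ m * (m ^ m * m ^ m) * (P * R) ≡⟨ regroup (4 ^ m) (m ^ m) P R ⟩
  4 ^ m * (m ^ m * P) * (m ^ m * R) ≤⟨ *-mono-≤ (*-monoʳ-≤ (4 ^ m) mᵐP≤xᵐ) mᵐR≤yᵐ ⟩
  4 ^ m * x ^ m * y ^ m             ≡⟨ *-assoc (4 ^ m) (x ^ m) (y ^ m) ⟩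
  4 ^ m * (x ^ m * y ^ m)           ≡⟨ cong (4 ^ m *_) (sym (^-distribʳ-* x y m)) ⟩
  4 ^ m * (x * y) ^ m               ≡⟨ sym (^-distribʳ-* 4 (x * y) m) ⟩
  (4 * (x * y)) ^ m                 ≤⟨ ^-monoˡ-≤ m (4xy≤[x+y]² x y) ⟩
  ((x + y) ^ 2) ^ m                 ≡⟨ ^-*-assoc (x + y) 2 m ⟩
  (x + y) ^ (2 * m)                 ∎
  where
  open ≤-Reasoning
  square : ∀ a → (2 * a) * ((2 * a) * 1) ≡ 4 * (a * a)
  square = solve-∀
  regroup : ∀ f a b c → f * (a * a) * (b * c) ≡ f * (a * b) * (a * c)
  regroup = solve-∀

x∸1∸c≡x∸[c+1] : ∀ x c → x ∸ 1 ∸ c ≡ x ∸ (c + 1)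
x∸1∸c≡x∸[c+1] x c = trans (∸-+-assoc x 1 c) (cong (x ∸_) (+-comm 1 c))

x∸1∸c+[c+1]≡x : ∀ {x} c → c + 1 ≤ x → x ∸ 1 ∸ c + (c + 1) ≡ x
x∸1∸c+[c+1]≡x {x} c c+1≤x = trans (cong (_+ (c + 1)) (x∸1∸c≡x∸[c+1] x c)) (m∸n+n≡m c+1≤x)

slack-sum-≤ : ∀ m c₁ c₂ c P R Q M₁ M₂ → M₁ + (c₁ + 1) ≡ P + m → M₂ + (c₂ + 1) ≡ R + m →
  c + P + R ≤ c₁ + c₂ + Q + 1 → M₁ + M₂ + (c + 1) ≤ Q + 2 * m
slack-sum-≤ m c₁ c₂ c P R Q M₁ M₂ e₁ e₂ count = +-cancelʳ-≤ (P + R) _ _ (begin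
  M₁ + M₂ + (c + 1) + (P + R)                ≡⟨ regroupˡ M₁ M₂ c P R ⟩
  M₁ + M₂ + (c + P + R + 1)                  ≤⟨ +-monoʳ-≤ (M₁ + M₂) (+-monoˡ-≤ 1 count) ⟩
  M₁ + M₂ + (c₁ + c₂ + Q + 1 + 1)            ≡⟨ regroupʳ M₁ M₂ c₁ c₂ Q ⟩
  M₁ + (c₁ + 1) + (M₂ + (c₂ + 1)) + Q        ≡⟨ cong₂ (λ a b → a + b + Q) e₁ e₂ ⟩
  P + m + (R + m) + Q                        ≡⟨ regroup m P R Q ⟩
  Q + 2 * m + (P + R)                        ∎)
  where
  open ≤-Reasoning
  regroupˡ : ∀ a b c d e → a + b + (c + 1) + (d + e) ≡ a + b + (c + d + e + 1)
  regroupˡ = solve-∀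
  regroupʳ : ∀ a b c d e → a + b + (c + d + e + 1 + 1) ≡ a + (c + 1) + (b + (d + 1)) + e
  regroupʳ = solve-∀
  regroup : ∀ a b c d → b + a + (c + a) + d ≡ d + 2 * a + (b + c)
  regroup = solve-∀

-- c ≤ P + m − 1 − m·P^(1/m), with the root cleared as in the statement.
Bound : ℕ → ℕ → ℕ → Set
Bound m c P = (c + 1 ≤ P + m) × (m ^ m * P ≤ (P + m ∸ 1 ∸ c) ^ m)

bound? : ∀ m c P → Dec (Bound m c P)
bound? m c P = (c + 1 ≤? P + m) ×-dec (m ^ m * P ≤? (P + m ∸ 1 ∸ c) ^ m)

bound-1-0 : ∀ P → Bound 1 0 P
bound-1-0 P rewrite m+n∸n≡m P 1 =
  m≤n+m 1 P , ≤-reflexive (trans (+-identityʳ P) (sym (*-identityʳ P)))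

bound-combine : ∀ {m c₁ c₂ c P R} → Bound m c₁ P → Bound m c₂ R →
  c + P + R ≤ c₁ + c₂ + P * R + 1 → Bound (2 * m) c (P * R)
bound-combine {m} {c₁} {c₂} {c} {P} {R} (c₁+1≤P+m , mᵐP≤M₁ᵐ) (c₂+1≤R+m , mᵐR≤M₂ᵐ) count =
  m+n≤o⇒n≤o (M₁ + M₂) slack , (begin
    (2 * m) ^ (2 * m) * (P * R) ≤⟨ [2m]^[2m]*PR≤[x+y]^[2m] m M₁ M₂ P R mᵐP≤M₁ᵐ mᵐR≤M₂ᵐ ⟩
    (M₁ + M₂) ^ (2 * m)         ≤⟨ ^-monoˡ-≤ (2 * m) M₁+M₂≤M ⟩
    (P * R + 2 * m ∸ 1 ∸ c) ^ (2 * m) ∎)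
  where
  open ≤-Reasoning
  M₁ = P + m ∸ 1 ∸ c₁
  M₂ = R + m ∸ 1 ∸ c₂
  slack : M₁ + M₂ + (c + 1) ≤ P * R + 2 * m
  slack = slack-sum-≤ m c₁ c₂ c P R (P * R) M₁ M₂
    (x∸1∸c+[c+1]≡x c₁ c₁+1≤P+m) (x∸1∸c+[c+1]≡x c₂ c₂+1≤R+m) count
  M₁+M₂≤M : M₁ + M₂ ≤ P * R + 2 * m ∸ 1 ∸ c
  M₁+M₂≤M = subst (M₁ + M₂ ≤_) (sym (x∸1∸c≡x∸[c+1] (P * R + 2 * m) c)) (m+n≤o⇒m≤o∸n (M₁ + M₂) slack)

𝟙 : Bool → ℕ
𝟙 true  = 1
𝟙 false = 0

∑ : {X : Set} → (X → ℕ) → List X → ℕ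
∑ f []       = 0
∑ f (x ∷ xs) = f x + ∑ f xs

countTrue≡∑𝟙 : {X : Set} (p : X → Bool) (xs : List X) → countTrue p xs ≡ ∑ (𝟙 ∘ p) xs
countTrue≡∑𝟙 p []       = refl
countTrue≡∑𝟙 p (x ∷ xs) with p x
... | true  = cong suc (countTrue≡∑𝟙 p xs)
... | false = countTrue≡∑𝟙 p xs

∑-++ : {X : Set} (f : X → ℕ) (xs ys : List X) → ∑ f (xs ++ ys) ≡ ∑ f xs + ∑ f ys
∑-++ f []       ys = refl
∑-++ f (x ∷ xs) ys = trans (cong (f x +_) (∑-++ f xs ys)) (sym (+-assoc (f x) _ _))

∑-map : {X Y : Set} (f : Y → ℕ) (g : X → Y) (xs : List X) → ∑ f (map g xs) ≡ ∑ (f ∘ g) xs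
∑-map f g []       = refl
∑-map f g (x ∷ xs) = cong (f (g x) +_) (∑-map f g xs)

∑-+ : {X : Set} (f g : X → ℕ) (xs : List X) → ∑ (λ x → f x + g x) xs ≡ ∑ f xs + ∑ g xs
∑-+ f g []       = refl
∑-+ f g (x ∷ xs) = trans (cong (f x + g x +_) (∑-+ f g xs)) (+-interchange (f x) (g x) (∑ f xs) (∑ g xs))

∑-mono : {X : Set} {f g : X → ℕ} (xs : List X) → (∀ x → f x ≤ g x) → ∑ f xs ≤ ∑ g xs
∑-mono []       f≤g = z≤n
∑-mono (x ∷ xs) f≤g = +-mono-≤ (f≤g x) (∑-mono xs f≤g)

∑-cong : {X : Set} {f g : X → ℕ} (xs : List X) → (∀ x → f x ≡ g x) → ∑ f xs ≡ ∑ g xs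
∑-cong []       f≗g = refl
∑-cong (x ∷ xs) f≗g = cong₂ _+_ (f≗g x) (∑-cong xs f≗g)

∑-allSubsets-suc : ∀ {N} (f : Subset (suc N) → ℕ) →
  ∑ f (allSubsets (suc N)) ≡ ∑ (f ∘ (outside ∷_)) (allSubsets N) + ∑ (f ∘ (inside ∷_)) (allSubsets N)
∑-allSubsets-suc {N} f = trans (∑-++ f (map (outside ∷_) S) (map (inside ∷_) S))
  (cong₂ _+_ (∑-map f (outside ∷_) S) (∑-map f (inside ∷_) S))
  where S = allSubsets N

countTrue>0⇒∃ : {X : Set} (p : X → Bool) (xs : List X) → 0 < countTrue p xs → ∃ λ x → p x ≡ true
countTrue>0⇒∃ p (x ∷ xs) 0<count with p x in px
... | true  = x , px
... | false = countTrue>0⇒∃ p xs 0<count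

-- `does` rather than `⌊_⌋`, which gets stuck on the `Dec.map` in the recursive cases of `_⊆?_`.
_⊆ᵇ_ : ∀ {N} → Subset N → Subset N → Bool
a ⊆ᵇ z = does (a ⊆? z)

⊆ᵇ-⊤ : ∀ {N} (a : Subset N) → a ⊆ᵇ ⊤ ≡ true
⊆ᵇ-⊤ []            = refl
⊆ᵇ-⊤ (outside ∷ a) = ⊆ᵇ-⊤ a
⊆ᵇ-⊤ (inside ∷ a)  = ⊆ᵇ-⊤ a

⊆ᵇ-∩ : ∀ {N} (a z w : Subset N) → a ⊆ᵇ (z ∩ w) ≡ a ⊆ᵇ z ∧ a ⊆ᵇ w
⊆ᵇ-∩ []            []            []            = refl
⊆ᵇ-∩ (outside ∷ a) (_ ∷ z)       (_ ∷ w)       = ⊆ᵇ-∩ a z w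
⊆ᵇ-∩ (inside ∷ a)  (outside ∷ z) (_ ∷ w)       = refl
⊆ᵇ-∩ (inside ∷ a)  (inside ∷ z)  (outside ∷ w) = sym (∧-zeroʳ (a ⊆ᵇ z))
⊆ᵇ-∩ (inside ∷ a)  (inside ∷ z)  (inside ∷ w)  = ⊆ᵇ-∩ a z w

⊆ᵇ-∁⇒⊆ᵇ-⊥ : ∀ {N} (a w : Subset N) → a ⊆ᵇ w ≡ true → a ⊆ᵇ ∁ w ≡ true → a ⊆ᵇ ⊥ ≡ true
⊆ᵇ-∁⇒⊆ᵇ-⊥ []            []            _   _    = refl
⊆ᵇ-∁⇒⊆ᵇ-⊥ (outside ∷ a) (_ ∷ w)       a⊆w a⊆∁w = ⊆ᵇ-∁⇒⊆ᵇ-⊥ a w a⊆w a⊆∁w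
⊆ᵇ-∁⇒⊆ᵇ-⊥ (inside ∷ a)  (outside ∷ w) ()  _
⊆ᵇ-∁⇒⊆ᵇ-⊥ (inside ∷ a)  (inside ∷ w)  _   ()

∑-zero : {X : Set} (xs : List X) → ∑ (λ _ → 0) xs ≡ 0
∑-zero []       = refl
∑-zero (x ∷ xs) = ∑-zero xs

∑⊆ᵇ≡2^∣z∣ : ∀ N (z : Subset N) → ∑ (λ a → 𝟙 (a ⊆ᵇ z)) (allSubsets N) ≡ 2 ^ ∣ z ∣
∑⊆ᵇ≡2^∣z∣ zero    []            = refl
∑⊆ᵇ≡2^∣z∣ (suc N) (outside ∷ z) = trans (∑-allSubsets-suc (λ a → 𝟙 (a ⊆ᵇ (outside ∷ z))))
  (trans (cong₂ _+_ (∑⊆ᵇ≡2^∣z∣ N z) (∑-zero (allSubsets N))) (+-identityʳ _))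
∑⊆ᵇ≡2^∣z∣ (suc N) (inside ∷ z)  = trans (∑-allSubsets-suc (λ a → 𝟙 (a ⊆ᵇ (inside ∷ z))))
  (trans (cong₂ _+_ (∑⊆ᵇ≡2^∣z∣ N z) (∑⊆ᵇ≡2^∣z∣ N z)) (cong (2 ^ ∣ z ∣ +_) (sym (+-identityʳ _))))

∣p∩q∣+∣p∩∁q∣≡∣p∣ : ∀ {N} (p q : Subset N) → ∣ p ∩ q ∣ + ∣ p ∩ ∁ q ∣ ≡ ∣ p ∣
∣p∩q∣+∣p∩∁q∣≡∣p∣ []            []            = refl
∣p∩q∣+∣p∩∁q∣≡∣p∣ (outside ∷ p) (_ ∷ q)       = ∣p∩q∣+∣p∩∁q∣≡∣p∣ p q
∣p∩q∣+∣p∩∁q∣≡∣p∣ (inside ∷ p)  (outside ∷ q) = trans (+-suc _ _) (cong suc (∣p∩q∣+∣p∩∁q∣≡∣p∣ p q))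
∣p∩q∣+∣p∩∁q∣≡∣p∣ (inside ∷ p)  (inside ∷ q)  = cong suc (∣p∩q∣+∣p∩∁q∣≡∣p∣ p q)

-- One subset a at a time: b, s, p, q, e stand for a ∈ B, a ⊆ z, a ⊆ w, a ⊆ ∁ w, a = ∅.
𝟙-split : ∀ b s p q e → (b ≡ true → s ≡ true) → (p ≡ true → q ≡ true → e ≡ true) →
  𝟙 b + 𝟙 (s ∧ p) + 𝟙 (s ∧ q) ≤ 𝟙 (b ∧ p) + 𝟙 (b ∧ q) + 𝟙 s + 𝟙 e
𝟙-split true  false _     _     _ b⇒s _ with b⇒s refl
... | ()
𝟙-split false false _     _     _ _ _ = z≤n
𝟙-split true  true  p     q     e _ _ = begin
  1 + 𝟙 p + 𝟙 q         ≡⟨ +-comm 1 (𝟙 p + 𝟙 q) ⟩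
  𝟙 p + 𝟙 q + 1         ≤⟨ m≤m+n _ (𝟙 e) ⟩
  𝟙 p + 𝟙 q + 1 + 𝟙 e   ∎
  where open ≤-Reasoning
𝟙-split false true  true  true  e _ p∧q⇒e rewrite p∧q⇒e refl refl = ≤-refl
𝟙-split false true  true  false _ _ _ = s≤s z≤n
𝟙-split false true  false true  _ _ _ = s≤s z≤n
𝟙-split false true  false false _ _ _ = z≤n

SupportedOn : ∀ {N} → Family N → Subset N → Set
SupportedOn {N} B z = (a : Subset N) → B a ≡ true → a ⊆ᵇ z ≡ true

↾-supportedOn : ∀ {N} {B : Family N} {z} w → SupportedOn B z → SupportedOn (B ↾ w) (z ∩ w)
↾-supportedOn {B = B} {z} w B⊆z a Ba∧a⊆w = trans (⊆ᵇ-∩ a z w) (cong₂ _∧_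
  (B⊆z a (∧-conicalˡ _ _ Ba∧a⊆w))
  (trans (sym (isYes≗does (a ⊆? w))) (∧-conicalʳ (B a) _ Ba∧a⊆w)))

card-↾ : ∀ {N} (B : Family N) w → card (B ↾ w) ≡ ∑ (λ a → 𝟙 (B a ∧ a ⊆ᵇ w)) (allSubsets N)
card-↾ {N} B w = trans (countTrue≡∑𝟙 (B ↾ w) (allSubsets N))
  (∑-cong (allSubsets N) (λ a → cong (λ t → 𝟙 (B a ∧ t)) (isYes≗does (a ⊆? w))))

∑⊆∩≡2^∣z∩w∣ : ∀ {N} (z w : Subset N) → ∑ (λ a → 𝟙 (a ⊆ᵇ z ∧ a ⊆ᵇ w)) (allSubsets N) ≡ 2 ^ ∣ z ∩ w ∣
∑⊆∩≡2^∣z∩w∣ {N} z w = trans (∑-cong (allSubsets N) (λ a → cong 𝟙 (sym (⊆ᵇ-∩ a z w)))) (∑⊆ᵇ≡2^∣z∣ N (z ∩ w))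

card-↾-split : ∀ {N} (B : Family N) z w → SupportedOn B z →
  card B + 2 ^ ∣ z ∩ w ∣ + 2 ^ ∣ z ∩ ∁ w ∣ ≤ card (B ↾ w) + card (B ↾ ∁ w) + 2 ^ ∣ z ∣ + 1
card-↾-split {N} B z w B⊆z = begin
  card B + 2 ^ ∣ z ∩ w ∣ + 2 ^ ∣ z ∩ ∁ w ∣               ≡⟨ lhs≡∑ ⟩
  ∑ (λ a → 𝟙 (B a) + 𝟙⊆∩ w a + 𝟙⊆∩ (∁ w) a) S             ≤⟨ ∑-mono S pointwise ⟩
  ∑ (λ a → 𝟙B∧⊆ w a + 𝟙B∧⊆ (∁ w) a + 𝟙⊆ z a + 𝟙⊆ ⊥ a) S ≡⟨ ∑≡rhs ⟩
  card (B ↾ w) + card (B ↾ ∁ w) + 2 ^ ∣ z ∣ + 1           ∎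
  where
  open ≤-Reasoning
  S = allSubsets N
  𝟙⊆ 𝟙⊆∩ 𝟙B∧⊆ : Subset N → Subset N → ℕ
  𝟙⊆ v a = 𝟙 (a ⊆ᵇ v)
  𝟙⊆∩ v a = 𝟙 (a ⊆ᵇ z ∧ a ⊆ᵇ v)
  𝟙B∧⊆ v a = 𝟙 (B a ∧ a ⊆ᵇ v)

  pointwise : ∀ a → 𝟙 (B a) + 𝟙⊆∩ w a + 𝟙⊆∩ (∁ w) a ≤ 𝟙B∧⊆ w a + 𝟙B∧⊆ (∁ w) a + 𝟙⊆ z a + 𝟙⊆ ⊥ a
  pointwise a = 𝟙-split (B a) (a ⊆ᵇ z) (a ⊆ᵇ w) (a ⊆ᵇ ∁ w) (a ⊆ᵇ ⊥) (B⊆z a) (⊆ᵇ-∁⇒⊆ᵇ-⊥ a w)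

  lhs≡∑ : card B + 2 ^ ∣ z ∩ w ∣ + 2 ^ ∣ z ∩ ∁ w ∣ ≡ ∑ (λ a → 𝟙 (B a) + 𝟙⊆∩ w a + 𝟙⊆∩ (∁ w) a) S
  lhs≡∑ = sym (trans (∑-+ (λ a → 𝟙 (B a) + 𝟙⊆∩ w a) (𝟙⊆∩ (∁ w)) S) (cong₂ _+_
    (trans (∑-+ (𝟙 ∘ B) (𝟙⊆∩ w) S) (cong₂ _+_ (sym (countTrue≡∑𝟙 B S)) (∑⊆∩≡2^∣z∩w∣ z w)))
    (∑⊆∩≡2^∣z∩w∣ z (∁ w))))

  ∑≡rhs : ∑ (λ a → 𝟙B∧⊆ w a + 𝟙B∧⊆ (∁ w) a + 𝟙⊆ z a + 𝟙⊆ ⊥ a) S ≡ card (B ↾ w) + card (B ↾ ∁ w) + 2 ^ ∣ z ∣ + 1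
  ∑≡rhs = trans (∑-+ (λ a → 𝟙B∧⊆ w a + 𝟙B∧⊆ (∁ w) a + 𝟙⊆ z a) (𝟙⊆ ⊥) S) (cong₂ _+_
    (trans (∑-+ (λ a → 𝟙B∧⊆ w a + 𝟙B∧⊆ (∁ w) a) (𝟙⊆ z) S) (cong₂ _+_
      (trans (∑-+ (𝟙B∧⊆ w) (𝟙B∧⊆ (∁ w)) S) (cong₂ _+_ (sym (card-↾ B w)) (sym (card-↾ B (∁ w)))))
      (∑⊆ᵇ≡2^∣z∣ N z)))
    (trans (∑⊆ᵇ≡2^∣z∣ N ⊥) (cong (2 ^_) (∣⊥∣≡0 N))))

¬Bound⇒NormGE : ∀ {N} n (B : Family N) z → SupportedOn B z →
  ¬ Bound (2 ^ n) (card B) (2 ^ ∣ z ∣) → NormGE (suc n) B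
¬Bound⇒NormGE {N} zero B z _ ¬bound =
  countTrue>0⇒∃ B (allSubsets N) (n≢0⇒n>0 λ |B|≡0 → ¬bound (subst (λ c → Bound 1 c _) (sym |B|≡0) (bound-1-0 _)))
¬Bound⇒NormGE (suc n) B z B⊆z ¬bound w
  with bound? (2 ^ n) (card (B ↾ w)) (2 ^ ∣ z ∩ w ∣) | bound? (2 ^ n) (card (B ↾ ∁ w)) (2 ^ ∣ z ∩ ∁ w ∣)
... | no ¬b₁ | _      = inj₁ (¬Bound⇒NormGE n (B ↾ w) (z ∩ w) (↾-supportedOn w B⊆z) ¬b₁)
... | yes _  | no ¬b₂ = inj₂ (¬Bound⇒NormGE n (B ↾ ∁ w) (z ∩ ∁ w) (↾-supportedOn (∁ w) B⊆z) ¬b₂)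
... | yes b₁ | yes b₂ = ⊥-elim (¬bound (subst (Bound (2 ^ suc n) (card B)) PR≡2^∣z∣ (bound-combine b₁ b₂ count)))
  where
  PR≡2^∣z∣ : 2 ^ ∣ z ∩ w ∣ * 2 ^ ∣ z ∩ ∁ w ∣ ≡ 2 ^ ∣ z ∣
  PR≡2^∣z∣ = trans (sym (^-distribˡ-+-* 2 ∣ z ∩ w ∣ ∣ z ∩ ∁ w ∣)) (cong (2 ^_) (∣p∩q∣+∣p∩∁q∣≡∣p∣ z w))
  count : card B + 2 ^ ∣ z ∩ w ∣ + 2 ^ ∣ z ∩ ∁ w ∣ ≤
          card (B ↾ w) + card (B ↾ ∁ w) + 2 ^ ∣ z ∩ w ∣ * 2 ^ ∣ z ∩ ∁ w ∣ + 1
  count = ≤-trans (card-↾-split B z w B⊆z)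
    (≤-reflexive (cong (λ t → card (B ↾ w) + card (B ↾ ∁ w) + t + 1) (sym PR≡2^∣z∣)))

mainTheorem11 : (N k : ℕ) (A : Family N) →
    ((a : Subset N) → A a ≡ true → 2 ≤ ∣ a ∣) →
    NormEq k A →
    (card A + 1 ≤ 2 ^ N + 2 ^ k) ×
    ((2 ^ k) ^ (2 ^ k) * 2 ^ N ≤ (2 ^ N + 2 ^ k ∸ 1 ∸ card A) ^ (2 ^ k))
mainTheorem11 N k A _ (_ , ¬NormGE) with bound? (2 ^ k) (card A) (2 ^ N)
... | yes bound = bound
... | no ¬bound = ⊥-elim (¬NormGE (¬Bound⇒NormGE k A ⊤ (λ a _ → ⊆ᵇ-⊤ a) ¬bound′))
  where
  ¬bound′ : ¬ Bound (2 ^ k) (card A) (2 ^ ∣ ⊤ {N} ∣)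
  ¬bound′ = subst (λ t → ¬ Bound (2 ^ k) (card A) (2 ^ t)) (sym (∣⊤∣≡n N)) ¬bound
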